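{- Let $I$ be an independent set of a claw-free graph $G$, let $C$ be an $I$-bad cycle with $I$-bipartition $[A,B]$, and let $S=I_0,\ldots,I_m$ be a TS-sequence with $I_0=I$. Then: (a) $S$ contains a resolving sequence for $C$ if and only if $S$ contains a move $u\to v$ with $u\in N_2(B)$ and $v\in N_1(B)$; (b) for every index $i$ such that $I_0,\ldots,I_i$ contains no resolving sequence for $C$, we have $I_i\subseteq N_2(B)\cup N_0(B)$, and, if $i\ge 1$, $I_i$ is obtained from $I_{i-1}$ by a move $u\to v$ with $N(u)\cap B=N(v)\cap B$.
   Context: Graphs are finite and simple; claw-free means no induced $K_{1,3}$. For $S'\subseteq V(G)$, $N_j(S')=\{v\in V(G)\setminus S':|N(v)\cap S'|=j\}$. A TS-sequence is a sequence of independent sets $I_0,\ldots,I_m$ where each $I_{i+1}$ arises from $I_i$ by a move $u\to v$: $uv\in E(G)$, $I_i\setminus I_{i+1}=\{u\}$, $I_{i+1}\setminus I_i=\{v\}$. A cycle $v_0,\ldots,v_k=v_0$ is $I$-bad if $|\{v_i,v_{i+1}\}\cap I|=1$ for all $i$ and $G[\{v_0,\ldots,v_{k-1}\}]$ is a cycle; its $I$-bipartition is $[A,B]=[V(C)\cap I,V(C)\setminus I]$. The sequence $I_0,\ldots,I_m$ (with $I_0=I$) contains a resolving sequence for $C$ if for some $i\in\{0,\ldots,m\}$ the graph $G[I_i\cup B]$ contains no cycle. -}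

module Defs where

open import Data.Nat using (ℕ; zero; suc; _+_; _≤_; _<_; _%_)
open import Data.Nat.DivMod using (m%n<n)
open import Data.Bool using (Bool; true; false)
open import Data.Fin using (Fin; toℕ; fromℕ<)
open import Data.Fin.Subset using (Subset; _∈_; _∉_; _⊆_; _∩_; _∪_; _─_; ⋃; ⁅_⁆; ∣_∣)
open import Data.List using (List; tabulate)
open import Data.Vec using () renaming (tabulate to vtabulate)
open import Data.Product using (Σ; ∃; ∃-syntax; _×_)
open import Data.Sum using (_⊎_)
open import Data.Empty using (⊥)
open import Relation.Nullary using (¬_)
open import Relation.Binary.PropositionalEquality using (_≡_; _≢_)
open import Function using (_⇔_)
open import Function.Definitions using (Injective)

record Graph (n : ℕ) : Set where
  field
    E     : Fin n → Fin n → Bool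
    sym   : ∀ u v → E u v ≡ E v u
    irrefl : ∀ v → E v v ≡ false
open Graph public

module _ {n : ℕ} (G : Graph n) where

  Adj : Fin n → Fin n → Set
  Adj u v = E G u v ≡ true

  Nbhd : Fin n → Subset n
  Nbhd v = vtabulate (λ w → E G v w)

  ClawFree : Set
  ClawFree = ∀ c x y z → Adj c x → Adj c y → Adj c z →
             x ≢ y → x ≢ z → y ≢ z →
             ¬ Adj x y → ¬ Adj x z → ¬ Adj y z → ⊥

  Independent : Subset n → Set
  Independent I = ∀ u v → u ∈ I → v ∈ I → ¬ Adj u v


  InN : ℕ → Subset n → Fin n → Set
  InN j S' v = v ∉ S' × ∣ Nbhd v ∩ S' ∣ ≡ j

  Move : Subset n → Subset n → Fin n → Fin n → Set
  Move I J u v = Adj u v × (I ─ J ≡ ⁅ u ⁆) × (J ─ I ≡ ⁅ v ⁆)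

  -- TS-sequence I_0, …, I_m, given as a function ℕ → Subset n (only
  -- indices 0..m are meaningful)
  IsTSSeq : (m : ℕ) → (ℕ → Subset n) → Set
  IsTSSeq m S = (∀ i → i ≤ m → Independent (S i)) ×
                (∀ i → i < m → ∃[ u ] ∃[ v ] Move (S i) (S (suc i)) u v)

csuc : ∀ {k} → Fin (suc k) → Fin (suc k)
csuc {k} i = fromℕ< (m%n<n (suc (toℕ i)) (suc k))

module _ {n : ℕ} (G : Graph n) where

  HasCycleIn : Subset n → Set
  HasCycleIn X = ∃[ k ] Σ (Fin (3 + k) → Fin n) λ c →
                 Injective _≡_ _≡_ c × (∀ i → c i ∈ X) ×
                 (∀ i → Adj G (c i) (c (csuc i)))

  IBadCycle : Subset n → (k : ℕ) → (Fin (3 + k) → Fin n) → Set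
  IBadCycle I k c =
    Injective _≡_ _≡_ c ×
    (∀ i j → Adj G (c i) (c j) ⇔ (j ≡ csuc i ⊎ i ≡ csuc j)) ×
    (∀ i → (c i ∈ I × c (csuc i) ∉ I) ⊎ (c i ∉ I × c (csuc i) ∈ I))

  VC : ∀ {k} → (Fin (3 + k) → Fin n) → Subset n
  VC {k} c = ⋃ (tabulate (λ i → ⁅ c i ⁆))

  -- B-part of the I-bipartition [A,B] = [V(C) ∩ I, V(C) \ I]
  BPart : ∀ {k} → Subset n → (Fin (3 + k) → Fin n) → Subset n
  BPart I c = VC c ─ I

  -- I_0,…,I_r contains a resolving sequence for C (with B-part B):
  -- some I_i (i ≤ r) with G[I_i ∪ B] acyclic
  ContainsResolving : ℕ → (ℕ → Subset n) → Subset n → Set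
  ContainsResolving r S B = ∃[ i ] i ≤ r × ¬ HasCycleIn (S i ∪ B)

module Submission where

-- Call an independent set J a replica of C if an injective ρ on the positions of C fixes B
-- and sends each a ∈ A to a vertex of J with the same neighbours in B, and every vertex of J
-- with a neighbour in B is some ρ a. Then ρ traces a cycle of G[J ∪ B] which is a whole
-- component of G[J ∪ B]. By claw-freeness I is a replica, and for a replica J and a move
-- u → v, claw-freeness at the vertices of B gives N(v) ∩ B ⊆ N(u) ∩ B. If equality holds,
-- replacing u by v in ρ gives a replica of the new set. Otherwise u = ρ a has the two
-- B-neighbours of a and v has exactly one; a cycle of the new G[J′ ∪ B] then avoids v, so it
-- lies in G[J ∪ B], hence is the replica cycle, which passes through u ∉ J′ — so the move
-- resolves C. Hence the sets before the first resolving move are replicas, and each of them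
-- still forms a cycle with B; this gives both (a) and (b).

open import Defs hiding (sym)
open import Data.Bool using (true) renaming (_≟_ to _≟ᵇ_)
open import Data.Empty using (⊥; ⊥-elim)
open import Data.Fin using (Fin; toℕ) renaming (zero to fzero; suc to fsuc)
open import Data.Fin.Properties
  using (toℕ-fromℕ<; toℕ-injective; toℕ<n; 0≢1+n; suc-injective) renaming (_≟_ to _≟ᶠ_)
open import Data.Fin.Subset using (Subset; _∈_; _∉_; _⊆_; _∩_; _∪_; _─_; ⋃; ⁅_⁆; ∣_∣; inside)
open import Data.Fin.Subset.Properties
  using (x∈p∩q⁺; x∈p∩q⁻; x∈p∪q⁺; x∈p∪q⁻; ∉⊥; x∈⁅x⁆; x∈⁅y⁆⇒x≡y; ∣⁅x⁆∣≡1; ∣⊥∣≡0;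
         p─q⊆p; x∈p∧x∉q⇒x∈p─q; ⊆-antisym; Empty-unique; nonempty?; _∈?_; ∪-comm; ∪-identityˡ; ∪-identityʳ)
open import Data.List using (List; []; _∷_; tabulate)
open import Data.List.Relation.Unary.Any using (Any; here; there)
open import Data.List.Relation.Unary.Any.Properties using (tabulate⁺; tabulate⁻)
open import Data.Nat using (ℕ; zero; suc; _+_; _∸_; _%_; _≤_; _<_)
open import Data.Nat.Properties
  using (+-suc; +-comm; +-assoc; m+[n∸m]≡n; <⇒≤; ≤-trans; ≤-refl; <-≤-trans; m≤n⇒m≤1+n)
open import Data.Nat.DivMod using (%-distribˡ-+; m%n%n≡m%n; [m+n]%n≡m%n; m<n⇒m%n≡m)
open import Data.Nat.GeneralisedArithmetic using (iterate)
open import Data.Product using (∃-syntax; _×_; _,_; proj₁; proj₂)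
open import Data.Sum using (_⊎_; inj₁; inj₂)
open import Data.Vec using (_∷_; here; there)
open import Data.Vec.Properties using ([]=⇒lookup; lookup⇒[]=; lookup∘tabulate)
open import Function using (_∘_; _⇔_; mk⇔; Equivalence)
open import Function.Definitions using (Injective)
open import Relation.Nullary using (¬_; Dec; yes; no)
open import Relation.Binary.PropositionalEquality
  using (_≡_; _≢_; refl; sym; trans; cong; subst; module ≡-Reasoning)

iterate-preserves : ∀ {A : Set} (P : A → Set) {f : A → A} → (∀ {x} → P x → P (f x)) →
                    ∀ {x} d → P x → P (iterate f x d)
iterate-preserves P step zero    px = px
iterate-preserves P step (suc d) px = iterate-preserves P step d (step px)

module _ {k : ℕ} where

  private
    N : ℕ
    N = suc k

  toℕ-csuc : ∀ (i : Fin N) → toℕ (csuc i) ≡ suc (toℕ i) % N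
  toℕ-csuc i = toℕ-fromℕ< _

  toℕ-iterate-csuc : ∀ (i : Fin N) d → toℕ (iterate csuc i d) ≡ (toℕ i + d) % N
  toℕ-iterate-csuc i zero = begin
    toℕ i           ≡⟨ m<n⇒m%n≡m (toℕ<n i) ⟨
    toℕ i % N       ≡⟨ cong (_% N) (+-comm 0 (toℕ i)) ⟩
    (toℕ i + 0) % N ∎
    where open ≡-Reasoning
  toℕ-iterate-csuc i (suc d) = begin
    toℕ (iterate csuc (csuc i) d)       ≡⟨ toℕ-iterate-csuc (csuc i) d ⟩
    (toℕ (csuc i) + d) % N              ≡⟨ cong (λ x → (x + d) % N) (toℕ-csuc i) ⟩
    (suc (toℕ i) % N + d) % N           ≡⟨ %-distribˡ-+ (suc (toℕ i) % N) d N ⟩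
    (suc (toℕ i) % N % N + d % N) % N   ≡⟨ cong (λ x → (x + d % N) % N) (m%n%n≡m%n (suc (toℕ i)) N) ⟩
    (suc (toℕ i) % N + d % N) % N       ≡⟨ %-distribˡ-+ (suc (toℕ i)) d N ⟨
    (suc (toℕ i) + d) % N               ≡⟨ cong (_% N) (+-suc (toℕ i) d) ⟨
    (toℕ i + suc d) % N                 ∎
    where open ≡-Reasoning

  iterate-csuc-surjective : ∀ (i j : Fin N) → ∃[ d ] iterate csuc i d ≡ j
  iterate-csuc-surjective i j = d , toℕ-injective (begin
    toℕ (iterate csuc i d)             ≡⟨ toℕ-iterate-csuc i d ⟩
    (toℕ i + (N ∸ toℕ i + toℕ j)) % N ≡⟨ cong (_% N) (+-assoc (toℕ i) (N ∸ toℕ i) (toℕ j)) ⟨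
    (toℕ i + (N ∸ toℕ i) + toℕ j) % N ≡⟨ cong (λ x → (x + toℕ j) % N) (m+[n∸m]≡n (<⇒≤ (toℕ<n i))) ⟩
    (N + toℕ j) % N                   ≡⟨ cong (_% N) (+-comm N (toℕ j)) ⟩
    (toℕ j + N) % N                   ≡⟨ [m+n]%n≡m%n (toℕ j) N ⟩
    toℕ j % N                         ≡⟨ m<n⇒m%n≡m (toℕ<n j) ⟩
    toℕ j                             ∎)
    where
    open ≡-Reasoning
    d = N ∸ toℕ i + toℕ j

  csuc-induction : (P : Fin N → Set) → (∀ {j} → P j → P (csuc j)) → ∀ {i} → P i → ∀ j → P j
  csuc-induction P step {i} pi j with iterate-csuc-surjective i j
  ... | d , refl = iterate-preserves P step d pi

  cpred : Fin N → Fin N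
  cpred j = iterate csuc j k

  cpred-csuc : ∀ j → cpred (csuc j) ≡ j
  cpred-csuc j = toℕ-injective (begin
    toℕ (iterate csuc j N) ≡⟨ toℕ-iterate-csuc j N ⟩
    (toℕ j + N) % N        ≡⟨ [m+n]%n≡m%n (toℕ j) N ⟩
    toℕ j % N              ≡⟨ m<n⇒m%n≡m (toℕ<n j) ⟩
    toℕ j                  ∎)
    where open ≡-Reasoning

  csuc-cpred : ∀ j → csuc (cpred j) ≡ j
  csuc-cpred j = trans (csuc-iterate k) (cpred-csuc j)
    where
    csuc-iterate : ∀ {x} d → csuc (iterate csuc x d) ≡ iterate csuc (csuc x) d
    csuc-iterate zero    = refl
    csuc-iterate (suc d) = csuc-iterate d

three-values-in-two : ∀ {A : Set} {p q x y z : A} →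
  x ≡ p ⊎ x ≡ q → y ≡ p ⊎ y ≡ q → z ≡ p ⊎ z ≡ q → x ≢ y → x ≢ z → y ≢ z → ⊥
three-values-in-two (inj₁ refl) (inj₁ refl) _           x≢y _   _   = x≢y refl
three-values-in-two (inj₂ refl) (inj₂ refl) _           x≢y _   _   = x≢y refl
three-values-in-two (inj₁ refl) (inj₂ refl) (inj₁ refl) _   x≢z _   = x≢z refl
three-values-in-two (inj₁ refl) (inj₂ refl) (inj₂ refl) _   _   y≢z = y≢z refl
three-values-in-two (inj₂ refl) (inj₁ refl) (inj₁ refl) _   _   y≢z = y≢z refl
three-values-in-two (inj₂ refl) (inj₁ refl) (inj₂ refl) _   x≢z _   = x≢z refl

csuc≢cpred : ∀ {k} (i : Fin (3 + k)) → csuc i ≢ cpred i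
csuc≢cpred i csuc≡cpred =
  -- Otherwise csuc (csuc i) ≡ i, and the orbit {i, csuc i} of i would be all of Fin (3 + k).
  three-values-in-two (orbit fzero) (orbit (fsuc fzero)) (orbit (fsuc (fsuc fzero)))
    0≢1+n 0≢1+n (λ 1≡2 → 0≢1+n (suc-injective 1≡2))
  where
  step : ∀ {j} → j ≡ i ⊎ j ≡ csuc i → csuc j ≡ i ⊎ csuc j ≡ csuc i
  step (inj₁ refl) = inj₂ refl
  step (inj₂ refl) = inj₁ (trans (cong csuc csuc≡cpred) (csuc-cpred i))
  orbit : ∀ j → j ≡ i ⊎ j ≡ csuc i
  orbit = csuc-induction (λ j → j ≡ i ⊎ j ≡ csuc i) step (inj₁ refl)

x∈p─q⇒x∉q : ∀ {n} {x : Fin n} {p q : Subset n} → x ∈ p ─ q → x ∉ q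
x∈p─q⇒x∉q {p = _ ∷ _} {inside ∷ _}  ()           here
x∈p─q⇒x∉q {p = _ ∷ _} {_ ∷ _}       (there x∈p─q) (there x∈q) = x∈p─q⇒x∉q x∈p─q x∈q

p─q≡⁅x⁆⇒x∈p : ∀ {n} {x : Fin n} {p q : Subset n} → p ─ q ≡ ⁅ x ⁆ → x ∈ p
p─q≡⁅x⁆⇒x∈p {p = p} {q} eq = p─q⊆p p q (subst (_ ∈_) (sym eq) (x∈⁅x⁆ _))

p─q≡⁅x⁆⇒x∉q : ∀ {n} {x : Fin n} {p q : Subset n} → p ─ q ≡ ⁅ x ⁆ → x ∉ q
p─q≡⁅x⁆⇒x∉q eq = x∈p─q⇒x∉q (subst (_ ∈_) (sym eq) (x∈⁅x⁆ _))

p─q≡⁅x⁆∧y∈p∧y≢x⇒y∈q : ∀ {n} {x y : Fin n} {p q : Subset n} →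
                       p ─ q ≡ ⁅ x ⁆ → y ∈ p → y ≢ x → y ∈ q
p─q≡⁅x⁆∧y∈p∧y≢x⇒y∈q {y = y} {p} {q} eq y∈p y≢x with y ∈? q
... | yes y∈q = y∈q
... | no  y∉q = ⊥-elim (y≢x (x∈⁅y⁆⇒x≡y _ (subst (y ∈_) eq (x∈p∧x∉q⇒x∈p─q y∈p y∉q))))

x∈⋃⁺ : ∀ {n} {x : Fin n} {ps : List (Subset n)} → Any (x ∈_) ps → x ∈ ⋃ ps
x∈⋃⁺ (here  x∈p)  = x∈p∪q⁺ (inj₁ x∈p)
x∈⋃⁺ (there x∈ps) = x∈p∪q⁺ (inj₂ (x∈⋃⁺ x∈ps))

x∈⋃⁻ : ∀ {n} {x : Fin n} (ps : List (Subset n)) → x ∈ ⋃ ps → Any (x ∈_) ps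
x∈⋃⁻ []       x∈⊥   = ⊥-elim (∉⊥ x∈⊥)
x∈⋃⁻ (p ∷ ps) x∈p∪⋃ with x∈p∪q⁻ p (⋃ ps) x∈p∪⋃
... | inj₁ x∈p  = here x∈p
... | inj₂ x∈ps = there (x∈⋃⁻ ps x∈ps)

∣⁅x⁆∪⁅y⁆∣≡2 : ∀ {n} {x y : Fin n} → x ≢ y → ∣ ⁅ x ⁆ ∪ ⁅ y ⁆ ∣ ≡ 2
∣⁅x⁆∪⁅y⁆∣≡2 {x = fzero}  {fzero}  x≢y = ⊥-elim (x≢y refl)
∣⁅x⁆∪⁅y⁆∣≡2 {x = fzero}  {fsuc y} x≢y = cong suc (trans (cong ∣_∣ (∪-identityˡ ⁅ y ⁆)) (∣⁅x⁆∣≡1 y))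
∣⁅x⁆∪⁅y⁆∣≡2 {x = fsuc x} {fzero}  x≢y = cong suc (trans (cong ∣_∣ (∪-identityʳ ⁅ x ⁆)) (∣⁅x⁆∣≡1 x))
∣⁅x⁆∪⁅y⁆∣≡2 {x = fsuc x} {fsuc y} x≢y = ∣⁅x⁆∪⁅y⁆∣≡2 (λ x≡y → x≢y (cong fsuc x≡y))

module _ {n : ℕ} (G : Graph n) where

  Adj-sym : ∀ {u v} → Adj G u v → Adj G v u
  Adj-sym {u} {v} uv = trans (Graph.sym G v u) uv

  Adj? : ∀ u v → Dec (Adj G u v)
  Adj? u v = E G u v ≟ᵇ true

  ∈Nbhd∩⁺ : ∀ {v x p} → Adj G v x → x ∈ p → x ∈ Nbhd G v ∩ p
  ∈Nbhd∩⁺ {v} {x} vx x∈p = x∈p∩q⁺ (lookup⇒[]= x _ (trans (lookup∘tabulate (E G v) x) vx) , x∈p)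

  ∈Nbhd∩⁻ : ∀ {v x} p → x ∈ Nbhd G v ∩ p → Adj G v x × x ∈ p
  ∈Nbhd∩⁻ {v} {x} p x∈N∩p with x∈p∩q⁻ (Nbhd G v) p x∈N∩p
  ... | x∈N , x∈p = trans (sym (lookup∘tabulate (E G v) x)) ([]=⇒lookup x∈N) , x∈p

  Nbhd∩≡⇒Adj : ∀ {v w x p} → Nbhd G v ∩ p ≡ Nbhd G w ∩ p → Adj G w x → x ∈ p → Adj G v x
  Nbhd∩≡⇒Adj {p = p} eq wx x∈p = proj₁ (∈Nbhd∩⁻ p (subst (_ ∈_) (sym eq) (∈Nbhd∩⁺ wx x∈p)))

  ⁅x⁆∪⁅y⁆⊆Nbhd∩ : ∀ {v x y p} → Adj G v x → Adj G v y → x ∈ p → y ∈ p →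
                  ⁅ x ⁆ ∪ ⁅ y ⁆ ⊆ Nbhd G v ∩ p
  ⁅x⁆∪⁅y⁆⊆Nbhd∩ {x = x} {y} vx vy x∈p y∈p z∈pair with x∈p∪q⁻ ⁅ x ⁆ ⁅ y ⁆ z∈pair
  ... | inj₁ z∈⁅x⁆ rewrite x∈⁅y⁆⇒x≡y x z∈⁅x⁆ = ∈Nbhd∩⁺ vx x∈p
  ... | inj₂ z∈⁅y⁆ rewrite x∈⁅y⁆⇒x≡y y z∈⁅y⁆ = ∈Nbhd∩⁺ vy y∈p

  claw-free⇒≤2-neighbours-in-independent :
    ClawFree G → ∀ {K} → Independent G K → ∀ {b x y w} →
    Adj G b x → Adj G b y → Adj G b w → x ∈ K → y ∈ K → w ∈ K → x ≢ y → w ≡ x ⊎ w ≡ y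
  claw-free⇒≤2-neighbours-in-independent cf K-ind {b} {x} {y} {w} bx by bw x∈K y∈K w∈K x≢y
    with w ≟ᶠ x | w ≟ᶠ y
  ... | yes w≡x | _       = inj₁ w≡x
  ... | no  _   | yes w≡y = inj₂ w≡y
  ... | no  w≢x | no  w≢y = ⊥-elim (cf b x y w bx by bw x≢y (w≢x ∘ sym) (w≢y ∘ sym)
                                       (K-ind x y x∈K y∈K) (K-ind x w x∈K w∈K) (K-ind y w y∈K w∈K))

  module _ {k : ℕ} {d : Fin (3 + k) → Fin n} where

    cycle-cpred-adj : (∀ i → Adj G (d i) (d (csuc i))) → ∀ i → Adj G (d i) (d (cpred i))
    cycle-cpred-adj d-adj i = Adj-sym (subst (λ j → Adj G (d (cpred i)) (d j)) (csuc-cpred i) (d-adj (cpred i)))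

    cycle-neighbours-distinct : Injective _≡_ _≡_ d → ∀ i → d (csuc i) ≢ d (cpred i)
    cycle-neighbours-distinct d-inj i eq = csuc≢cpred i (d-inj eq)

  ClosedIn : ∀ {k} → Subset n → (Fin (suc k) → Fin n) → Set
  ClosedIn X ρ = ∀ j {y} → y ∈ X → Adj G (ρ j) y → y ≡ ρ (csuc j) ⊎ y ≡ ρ (cpred j)

  cycle-meeting-closed-covers-it :
    ∀ {k k′ X} {ρ : Fin (suc k) → Fin n} → ClosedIn X ρ →
    (d : Fin (3 + k′) → Fin n) → Injective _≡_ _≡_ d →
    (∀ i → d i ∈ X) → (∀ i → Adj G (d i) (d (csuc i))) →
    ∀ {i j} → d i ≡ ρ j → ∀ j′ → ∃[ i′ ] d i′ ≡ ρ j′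
  cycle-meeting-closed-covers-it {ρ = ρ} closed d d-inj d∈X d-adj {i} {j} di≡ρj =
    csuc-induction (λ j → ∃[ i ] d i ≡ ρ j) step (i , di≡ρj)
    where
    on-d : ∀ {i j} → d i ≡ ρ j → ∀ i′ → Adj G (d i) (d i′) →
           d i′ ≡ ρ (csuc j) ⊎ d i′ ≡ ρ (cpred j)
    on-d {i} {j} di≡ρj i′ adj = closed j (d∈X i′) (subst (λ x → Adj G x (d i′)) di≡ρj adj)
    step : ∀ {j} → ∃[ i ] d i ≡ ρ j → ∃[ i ] d i ≡ ρ (csuc j)
    step (i , di≡ρj) with on-d di≡ρj (csuc i) (d-adj i) | on-d di≡ρj (cpred i) (cycle-cpred-adj d-adj i)
    ... | inj₁ eq   | _         = csuc i , eq
    ... | inj₂ _    | inj₁ eq   = cpred i , eq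
    ... | inj₂ eq₁  | inj₂ eq₂  = ⊥-elim (cycle-neighbours-distinct d-inj i (trans eq₁ (sym eq₂)))

module BadCycle {n : ℕ} (G : Graph n) (cf : ClawFree G) (I : Subset n) (I-independent : Independent G I)
                {k : ℕ} (c : Fin (3 + k) → Fin n) (bad : IBadCycle G I k c) where

  B : Subset n
  B = BPart G I c

  c-injective : Injective _≡_ _≡_ c
  c-injective = proj₁ bad

  c-adj⁻ : ∀ {i j} → Adj G (c i) (c j) → j ≡ csuc i ⊎ i ≡ csuc j
  c-adj⁻ {i} {j} = Equivalence.to (proj₁ (proj₂ bad) i j)

  c-csuc-adj : ∀ i → Adj G (c i) (c (csuc i))
  c-csuc-adj i = Equivalence.from (proj₁ (proj₂ bad) i (csuc i)) (inj₁ refl)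

  c-cpred-adj : ∀ i → Adj G (c i) (c (cpred i))
  c-cpred-adj = cycle-cpred-adj G c-csuc-adj

  csuc-∉I : ∀ {j} → c j ∈ I → c (csuc j) ∉ I
  csuc-∉I {j} cj∈I with proj₂ (proj₂ bad) j
  ... | inj₁ (_ , next∉I) = next∉I
  ... | inj₂ (cj∉I , _)   = ⊥-elim (cj∉I cj∈I)

  csuc-∈I : ∀ {j} → c j ∉ I → c (csuc j) ∈ I
  csuc-∈I {j} cj∉I with proj₂ (proj₂ bad) j
  ... | inj₁ (cj∈I , _)   = ⊥-elim (cj∉I cj∈I)
  ... | inj₂ (_ , next∈I) = next∈I

  cpred-∉I : ∀ {j} → c j ∈ I → c (cpred j) ∉ I
  cpred-∉I {j} cj∈I prev∈I = csuc-∉I prev∈I (subst (λ i → c i ∈ I) (sym (csuc-cpred j)) cj∈I)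

  cpred-∈I : ∀ {j} → c j ∉ I → c (cpred j) ∈ I
  cpred-∈I {j} cj∉I with c (cpred j) ∈? I
  ... | yes prev∈I = prev∈I
  ... | no  prev∉I = ⊥-elim (cj∉I (subst (λ i → c i ∈ I) (csuc-cpred j) (csuc-∈I prev∉I)))

  ∈B⁺ : ∀ {j} → c j ∉ I → c j ∈ B
  ∈B⁺ {j} cj∉I = x∈p∧x∉q⇒x∈p─q (x∈⋃⁺ (tabulate⁺ {f = λ i → ⁅ c i ⁆} j (x∈⁅x⁆ (c j)))) cj∉I

  ∈B⁻ : ∀ {y} → y ∈ B → ∃[ j ] c j ∉ I × y ≡ c j
  ∈B⁻ {y} y∈B with tabulate⁻ (x∈⋃⁻ (tabulate (λ i → ⁅ c i ⁆)) (p─q⊆p (VC G c) I y∈B))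
  ... | j , y∈⁅cj⁆ with x∈⁅y⁆⇒x≡y (c j) y∈⁅cj⁆
  ...   | refl = j , x∈p─q⇒x∉q y∈B , refl

  csuc-∈B : ∀ {j} → c j ∈ I → c (csuc j) ∈ B
  csuc-∈B cj∈I = ∈B⁺ (csuc-∉I cj∈I)

  cpred-∈B : ∀ {j} → c j ∈ I → c (cpred j) ∈ B
  cpred-∈B cj∈I = ∈B⁺ (cpred-∉I cj∈I)

  B-independent : Independent G B
  B-independent y y′ y∈B y′∈B yy′ with ∈B⁻ y∈B | ∈B⁻ y′∈B
  ... | i , ci∉I , refl | j , cj∉I , refl with c-adj⁻ yy′
  ... | inj₁ refl = cj∉I (csuc-∈I ci∉I)
  ... | inj₂ refl = ci∉I (csuc-∈I cj∉I)

  A-Nbhd∩B⁻ : ∀ {j y} → c j ∈ I → y ∈ Nbhd G (c j) ∩ B → y ≡ c (csuc j) ⊎ y ≡ c (cpred j)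
  A-Nbhd∩B⁻ {j} cj∈I y∈N∩B with ∈Nbhd∩⁻ G B y∈N∩B
  ... | adj , y∈B with ∈B⁻ y∈B
  ...   | j′ , _ , refl with c-adj⁻ adj
  ...     | inj₁ refl = inj₁ refl
  ...     | inj₂ refl = inj₂ (cong c (sym (cpred-csuc j′)))

  A-Nbhd∩B≡ : ∀ {j} → c j ∈ I → Nbhd G (c j) ∩ B ≡ ⁅ c (csuc j) ⁆ ∪ ⁅ c (cpred j) ⁆
  A-Nbhd∩B≡ {j} cj∈I = ⊆-antisym ⊆-pair
    (⁅x⁆∪⁅y⁆⊆Nbhd∩ G (c-csuc-adj j) (c-cpred-adj j) (csuc-∈B cj∈I) (cpred-∈B cj∈I))
    where
    ⊆-pair : Nbhd G (c j) ∩ B ⊆ ⁅ c (csuc j) ⁆ ∪ ⁅ c (cpred j) ⁆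
    ⊆-pair y∈N∩B with A-Nbhd∩B⁻ cj∈I y∈N∩B
    ... | inj₁ refl = x∈p∪q⁺ (inj₁ (x∈⁅x⁆ _))
    ... | inj₂ refl = x∈p∪q⁺ (inj₂ (x∈⁅x⁆ _))

  next≢prev : ∀ j → c (csuc j) ≢ c (cpred j)
  next≢prev = cycle-neighbours-distinct G c-injective

  ∣A-Nbhd∩B∣≡2 : ∀ {j} → c j ∈ I → ∣ Nbhd G (c j) ∩ B ∣ ≡ 2
  ∣A-Nbhd∩B∣≡2 {j} cj∈I =
    trans (cong ∣_∣ (A-Nbhd∩B≡ cj∈I)) (∣⁅x⁆∪⁅y⁆∣≡2 (next≢prev j))

  record Replica (J : Subset n) : Set where
    field
      ρ           : Fin (3 + k) → Fin n
      ρ-injective : Injective _≡_ _≡_ ρ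
      ρ-B         : ∀ {j} → c j ∉ I → ρ j ≡ c j
      ρ-A         : ∀ {j} → c j ∈ I → ρ j ∈ J
      ρ-Nbhd      : ∀ {j} → c j ∈ I → Nbhd G (ρ j) ∩ B ≡ Nbhd G (c j) ∩ B
      ρ-cover     : ∀ {w y} → w ∈ J → y ∈ B → Adj G w y → ∃[ j ] c j ∈ I × w ≡ ρ j

  replica-I : Replica I
  replica-I = record
    { ρ = c ; ρ-injective = c-injective ; ρ-B = λ _ → refl ; ρ-A = λ cj∈I → cj∈I
    ; ρ-Nbhd = λ _ → refl ; ρ-cover = cover }
    where
    cover : ∀ {w y} → w ∈ I → y ∈ B → Adj G w y → ∃[ j ] c j ∈ I × w ≡ c j
    cover w∈I y∈B wy with ∈B⁻ y∈B
    ... | j , cj∉I , refl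
      with claw-free⇒≤2-neighbours-in-independent G cf I-independent
             (c-csuc-adj j) (c-cpred-adj j) (Adj-sym G wy) (csuc-∈I cj∉I) (cpred-∈I cj∉I) w∈I
             (next≢prev j)
    ... | inj₁ w≡next = csuc j , csuc-∈I cj∉I , w≡next
    ... | inj₂ w≡prev = cpred j , cpred-∈I cj∉I , w≡prev

  module ReplicaProperties {J : Subset n} (J-independent : Independent G J) (R : Replica J) where
    open Replica R public

    ρ-adj : ∀ {j y} → c j ∈ I → Adj G (c j) y → y ∈ B → Adj G (ρ j) y
    ρ-adj cj∈I = Nbhd∩≡⇒Adj G (ρ-Nbhd cj∈I)

    ρ-adj⁻ : ∀ {j y} → c j ∈ I → Adj G (ρ j) y → y ∈ B → Adj G (c j) y
    ρ-adj⁻ cj∈I = Nbhd∩≡⇒Adj G (sym (ρ-Nbhd cj∈I))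

    ρ-csuc-adj : ∀ j → Adj G (ρ j) (ρ (csuc j))
    ρ-csuc-adj j with c j ∈? I
    ... | yes cj∈I rewrite ρ-B (csuc-∉I cj∈I) = ρ-adj cj∈I (c-csuc-adj j) (csuc-∈B cj∈I)
    ... | no  cj∉I rewrite ρ-B cj∉I =
      Adj-sym G (ρ-adj (csuc-∈I cj∉I) (Adj-sym G (c-csuc-adj j)) (∈B⁺ cj∉I))

    ρ-cpred-adj : ∀ j → Adj G (ρ j) (ρ (cpred j))
    ρ-cpred-adj = cycle-cpred-adj G ρ-csuc-adj

    ∈B⇒ρ : ∀ {y} → y ∈ B → ∃[ j ] c j ∉ I × y ≡ ρ j
    ∈B⇒ρ y∈B with ∈B⁻ y∈B
    ... | j , cj∉I , y≡cj = j , cj∉I , trans y≡cj (sym (ρ-B cj∉I))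

    J∩B-empty : ∀ {w} → w ∈ J → w ∉ B
    J∩B-empty w∈J w∈B with ∈B⇒ρ w∈B
    ... | j , cj∉I , refl = J-independent _ _ w∈J (ρ-A (csuc-∈I cj∉I)) (ρ-csuc-adj j)

    ρ-∈J∪B : ∀ j → ρ j ∈ J ∪ B
    ρ-∈J∪B j with c j ∈? I
    ... | yes cj∈I = x∈p∪q⁺ (inj₁ (ρ-A cj∈I))
    ... | no  cj∉I = x∈p∪q⁺ (inj₂ (subst (_∈ B) (sym (ρ-B cj∉I)) (∈B⁺ cj∉I)))

    replica-cycle : HasCycleIn G (J ∪ B)
    replica-cycle = k , ρ , ρ-injective , ρ-∈J∪B , ρ-csuc-adj

    replica-closed : ClosedIn G (J ∪ B) ρ
    replica-closed j {y} y∈J∪B ρj-y with c j ∈? I | x∈p∪q⁻ J B y∈J∪B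
    ... | yes cj∈I | inj₁ y∈J = ⊥-elim (J-independent _ _ (ρ-A cj∈I) y∈J ρj-y)
    ... | yes cj∈I | inj₂ y∈B with A-Nbhd∩B⁻ cj∈I (∈Nbhd∩⁺ G (ρ-adj⁻ cj∈I ρj-y y∈B) y∈B)
    ...   | inj₁ y≡next = inj₁ (trans y≡next (sym (ρ-B (csuc-∉I cj∈I))))
    ...   | inj₂ y≡prev = inj₂ (trans y≡prev (sym (ρ-B (cpred-∉I cj∈I))))
    replica-closed j {y} y∈J∪B ρj-y | no cj∉I | inj₂ y∈B =
      ⊥-elim (B-independent _ _ (subst (_∈ B) (sym (ρ-B cj∉I)) (∈B⁺ cj∉I)) y∈B ρj-y)
    replica-closed j {y} y∈J∪B ρj-y | no cj∉I | inj₁ y∈J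
      with ρ-cover y∈J (∈B⁺ cj∉I) (Adj-sym G (subst (λ x → Adj G x y) (ρ-B cj∉I) ρj-y))
    ... | j′ , cj′∈I , refl
      with c-adj⁻ (ρ-adj⁻ cj′∈I (Adj-sym G (subst (λ x → Adj G x (ρ j′)) (ρ-B cj∉I) ρj-y))
                          (∈B⁺ cj∉I))
    ...   | inj₁ refl = inj₂ (cong ρ (sym (cpred-csuc j′)))
    ...   | inj₂ refl = inj₁ refl

    replica-N₂⊎N₀ : ∀ {w} → w ∈ J → InN G 2 B w ⊎ InN G 0 B w
    replica-N₂⊎N₀ {w} w∈J with nonempty? (Nbhd G w ∩ B)
    ... | no  empty = inj₂ (J∩B-empty w∈J , trans (cong ∣_∣ (Empty-unique empty)) (∣⊥∣≡0 n))
    ... | yes (y , y∈N∩B) with ∈Nbhd∩⁻ G B y∈N∩B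
    ...   | wy , y∈B with ρ-cover w∈J y∈B wy
    ...     | j , cj∈I , refl =
      inj₁ (J∩B-empty w∈J , trans (cong ∣_∣ (ρ-Nbhd cj∈I)) (∣A-Nbhd∩B∣≡2 cj∈I))

  module ReplicaMove {J J′ : Subset n} (J-independent : Independent G J) (J′-independent : Independent G J′)
                     (R : Replica J) {u v : Fin n} (move : Move G J J′ u v) where
    open ReplicaProperties J-independent R

    u∈J : u ∈ J
    u∈J = p─q≡⁅x⁆⇒x∈p (proj₁ (proj₂ move))

    u∉J′ : u ∉ J′
    u∉J′ = p─q≡⁅x⁆⇒x∉q (proj₁ (proj₂ move))

    v∈J′ : v ∈ J′
    v∈J′ = p─q≡⁅x⁆⇒x∈p (proj₂ (proj₂ move))

    v∉J : v ∉ J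
    v∉J = p─q≡⁅x⁆⇒x∉q (proj₂ (proj₂ move))

    stays-in-J′ : ∀ {w} → w ∈ J → w ≢ u → w ∈ J′
    stays-in-J′ = p─q≡⁅x⁆∧y∈p∧y≢x⇒y∈q (proj₁ (proj₂ move))

    stays-in-J : ∀ {w} → w ∈ J′ → w ≢ v → w ∈ J
    stays-in-J = p─q≡⁅x⁆∧y∈p∧y≢x⇒y∈q (proj₂ (proj₂ move))

    u∉B : u ∉ B
    u∉B = J∩B-empty u∈J

    -- The two replica vertices around a B-vertex are distinct, so one of them survives the move.
    v∉B : v ∉ B
    v∉B v∈B with ∈B⇒ρ v∈B
    ... | j , cj∉I , refl with ρ (csuc j) ≟ᶠ u
    ... | no  next≢u =
      J′-independent _ _ v∈J′ (stays-in-J′ (ρ-A (csuc-∈I cj∉I)) next≢u) (ρ-csuc-adj j)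
    ... | yes next≡u =
      J′-independent _ _ v∈J′ (stays-in-J′ (ρ-A (cpred-∈I cj∉I)) prev≢u) (ρ-cpred-adj j)
      where
      prev≢u : ρ (cpred j) ≢ u
      prev≢u prev≡u = cycle-neighbours-distinct G ρ-injective j (trans next≡u (sym prev≡u))

    Nbhd-v∩B⊆Nbhd-u∩B : Nbhd G v ∩ B ⊆ Nbhd G u ∩ B
    Nbhd-v∩B⊆Nbhd-u∩B y∈Nv∩B with ∈Nbhd∩⁻ G B y∈Nv∩B
    ... | vy , y∈B with ∈B⇒ρ y∈B
    ...   | j , cj∉I , refl with ρ (csuc j) ≟ᶠ u | ρ (cpred j) ≟ᶠ u
    ...     | yes refl | _        = ∈Nbhd∩⁺ G (Adj-sym G (ρ-csuc-adj j)) y∈B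
    ...     | no  _    | yes refl = ∈Nbhd∩⁺ G (Adj-sym G (ρ-cpred-adj j)) y∈B
    ...     | no next≢u | no prev≢u
      with claw-free⇒≤2-neighbours-in-independent G cf J′-independent
             (ρ-csuc-adj j) (ρ-cpred-adj j) (Adj-sym G vy)
             (stays-in-J′ (ρ-A (csuc-∈I cj∉I)) next≢u) (stays-in-J′ (ρ-A (cpred-∈I cj∉I)) prev≢u)
             v∈J′
             (cycle-neighbours-distinct G ρ-injective j)
    ...       | inj₁ refl = ⊥-elim (v∉J (ρ-A (csuc-∈I cj∉I)))
    ...       | inj₂ refl = ⊥-elim (v∉J (ρ-A (cpred-∈I cj∉I)))

    replace : Fin n → Fin n
    replace w with w ≟ᶠ u
    ... | yes _ = v
    ... | no  _ = w

    replace-cases : ∀ w → (w ≡ u × replace w ≡ v) ⊎ (w ≢ u × replace w ≡ w)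
    replace-cases w with w ≟ᶠ u
    ... | yes w≡u = inj₁ (w≡u , refl)
    ... | no  w≢u = inj₂ (w≢u , refl)

    ρ≢v : ∀ j → ρ j ≢ v
    ρ≢v j ρj≡v with x∈p∪q⁻ J B (ρ-∈J∪B j)
    ... | inj₁ ρj∈J = v∉J (subst (_∈ J) ρj≡v ρj∈J)
    ... | inj₂ ρj∈B = v∉B (subst (_∈ B) ρj≡v ρj∈B)

    replica-after-move : Nbhd G u ∩ B ≡ Nbhd G v ∩ B → Replica J′
    replica-after-move Nu≡Nv = record
      { ρ = replace ∘ ρ ; ρ-injective = injective ; ρ-B = B-fixed ; ρ-A = A-in-J′
      ; ρ-Nbhd = A-Nbhd ; ρ-cover = cover }
      where
      injective : Injective _≡_ _≡_ (replace ∘ ρ)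
      injective {i} {j} eq with replace-cases (ρ i) | replace-cases (ρ j)
      ... | inj₁ (ρi≡u , _)  | inj₁ (ρj≡u , _)  = ρ-injective (trans ρi≡u (sym ρj≡u))
      ... | inj₁ (_ , ri≡v)  | inj₂ (_ , rj≡ρj) =
        ⊥-elim (ρ≢v j (trans (sym rj≡ρj) (trans (sym eq) ri≡v)))
      ... | inj₂ (_ , ri≡ρi) | inj₁ (_ , rj≡v)  =
        ⊥-elim (ρ≢v i (trans (sym ri≡ρi) (trans eq rj≡v)))
      ... | inj₂ (_ , ri≡ρi) | inj₂ (_ , rj≡ρj) = ρ-injective (trans (sym ri≡ρi) (trans eq rj≡ρj))
      B-fixed : ∀ {j} → c j ∉ I → replace (ρ j) ≡ c j
      B-fixed {j} cj∉I with replace-cases (ρ j)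
      ... | inj₁ (ρj≡u , _)  = ⊥-elim (u∉B (subst (_∈ B) (trans (sym (ρ-B cj∉I)) ρj≡u) (∈B⁺ cj∉I)))
      ... | inj₂ (_ , r≡ρj) = trans r≡ρj (ρ-B cj∉I)
      A-in-J′ : ∀ {j} → c j ∈ I → replace (ρ j) ∈ J′
      A-in-J′ {j} cj∈I with replace-cases (ρ j)
      ... | inj₁ (_ , r≡v)      = subst (_∈ J′) (sym r≡v) v∈J′
      ... | inj₂ (ρj≢u , r≡ρj) = subst (_∈ J′) (sym r≡ρj) (stays-in-J′ (ρ-A cj∈I) ρj≢u)
      A-Nbhd : ∀ {j} → c j ∈ I → Nbhd G (replace (ρ j)) ∩ B ≡ Nbhd G (c j) ∩ B
      A-Nbhd {j} cj∈I with replace-cases (ρ j)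
      ... | inj₁ (refl , r≡v) = trans (cong (λ x → Nbhd G x ∩ B) r≡v) (trans (sym Nu≡Nv) (ρ-Nbhd cj∈I))
      ... | inj₂ (_ , r≡ρj)   = trans (cong (λ x → Nbhd G x ∩ B) r≡ρj) (ρ-Nbhd cj∈I)
      cover : ∀ {w y} → w ∈ J′ → y ∈ B → Adj G w y → ∃[ j ] c j ∈ I × w ≡ replace (ρ j)
      cover {w} w∈J′ y∈B wy with w ≟ᶠ v
      ... | yes refl with ρ-cover u∈J y∈B (Nbhd∩≡⇒Adj G Nu≡Nv wy y∈B)
      ...   | j , cj∈I , u≡ρj with replace-cases (ρ j)
      ...     | inj₁ (_ , r≡v)   = j , cj∈I , sym r≡v
      ...     | inj₂ (ρj≢u , _)  = ⊥-elim (ρj≢u (sym u≡ρj))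
      cover {w} w∈J′ y∈B wy | no w≢v with ρ-cover (stays-in-J w∈J′ w≢v) y∈B wy
      ... | j , cj∈I , w≡ρj with replace-cases (ρ j)
      ...   | inj₁ (ρj≡u , _)  = ⊥-elim (u∉J′ (subst (_∈ J′) (trans w≡ρj ρj≡u) w∈J′))
      ...   | inj₂ (_ , r≡ρj)  = j , cj∈I , trans w≡ρj (sym r≡ρj)

    no-cycle-after-move : ∀ {j₀ b} → u ≡ ρ j₀ → Nbhd G v ∩ B ≡ ⁅ b ⁆ → ¬ HasCycleIn G (J′ ∪ B)
    no-cycle-after-move {j₀} {b} u≡ρj₀ Nv≡b (k′ , d , d-injective , d∈J′∪B , d-adj) =
      d≢u (proj₁ ρj₀-on-d) (trans (proj₂ ρj₀-on-d) (sym u≡ρj₀))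
      where
      J′-neighbour-∈B : ∀ {i i′} → d i ∈ J′ → Adj G (d i) (d i′) → d i′ ∈ B
      J′-neighbour-∈B {i} {i′} di∈J′ adj with x∈p∪q⁻ J′ B (d∈J′∪B i′)
      ... | inj₁ di′∈J′ = ⊥-elim (J′-independent _ _ di∈J′ di′∈J′ adj)
      ... | inj₂ di′∈B  = di′∈B
      d≢v : ∀ i → d i ≢ v
      d≢v i refl = cycle-neighbours-distinct G d-injective i
                     (trans (only-b (d-adj i)) (sym (only-b (cycle-cpred-adj G d-adj i))))
        where
        only-b : ∀ {i′} → Adj G v (d i′) → d i′ ≡ b
        only-b adj = x∈⁅y⁆⇒x≡y b (subst (_ ∈_) Nv≡b (∈Nbhd∩⁺ G adj (J′-neighbour-∈B v∈J′ adj)))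
      d∈J∪B : ∀ i → d i ∈ J ∪ B
      d∈J∪B i with x∈p∪q⁻ J′ B (d∈J′∪B i)
      ... | inj₁ di∈J′ = x∈p∪q⁺ (inj₁ (stays-in-J di∈J′ (d≢v i)))
      ... | inj₂ di∈B  = x∈p∪q⁺ (inj₂ di∈B)
      d≢u : ∀ i → d i ≢ u
      d≢u i refl with x∈p∪q⁻ J′ B (d∈J′∪B i)
      ... | inj₁ u∈J′ = u∉J′ u∈J′
      ... | inj₂ u∈B  = u∉B u∈B
      d₀-on-ρ : ∃[ j ] d fzero ≡ ρ j
      d₀-on-ρ with x∈p∪q⁻ J′ B (d∈J′∪B fzero)
      ... | inj₂ d₀∈B  = let j , _ , d₀≡ρj = ∈B⇒ρ d₀∈B in j , d₀≡ρj
      ... | inj₁ d₀∈J′ =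
        let j , _ , d₀≡ρj = ρ-cover (stays-in-J d₀∈J′ (d≢v fzero))
                                    (J′-neighbour-∈B d₀∈J′ (d-adj fzero)) (d-adj fzero)
        in j , d₀≡ρj
      ρj₀-on-d : ∃[ i ] d i ≡ ρ j₀
      ρj₀-on-d =
        cycle-meeting-closed-covers-it G replica-closed d d-injective d∈J∪B d-adj (proj₂ d₀-on-ρ) j₀

    Nbhd-u∩B≡pair : ∀ {j₀} → c j₀ ∈ I → u ≡ ρ j₀ →
                    Nbhd G u ∩ B ≡ ⁅ c (csuc j₀) ⁆ ∪ ⁅ c (cpred j₀) ⁆
    Nbhd-u∩B≡pair cj₀∈I refl = trans (ρ-Nbhd cj₀∈I) (A-Nbhd∩B≡ cj₀∈I)

    resolving-move : ∀ {j₀ b b′} → u ≡ ρ j₀ → Nbhd G u ∩ B ≡ ⁅ b ⁆ ∪ ⁅ b′ ⁆ → b ≢ b′ → b ∈ B →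
                     Adj G v b → ¬ Adj G v b′ → InN G 2 B u × InN G 1 B v × ¬ HasCycleIn G (J′ ∪ B)
    resolving-move {b = b} {b′} u≡ρj₀ Nu≡pair b≢b′ b∈B vb ¬vb′ =
      (u∉B , trans (cong ∣_∣ Nu≡pair) (∣⁅x⁆∪⁅y⁆∣≡2 b≢b′)) ,
      (v∉B , trans (cong ∣_∣ Nv≡b) (∣⁅x⁆∣≡1 b)) ,
      no-cycle-after-move u≡ρj₀ Nv≡b
      where
      Nv⊆b : Nbhd G v ∩ B ⊆ ⁅ b ⁆
      Nv⊆b y∈Nv with x∈p∪q⁻ ⁅ b ⁆ ⁅ b′ ⁆ (subst (_ ∈_) Nu≡pair (Nbhd-v∩B⊆Nbhd-u∩B y∈Nv))
      ... | inj₁ y∈⁅b⁆  = y∈⁅b⁆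
      ... | inj₂ y∈⁅b′⁆ rewrite x∈⁅y⁆⇒x≡y b′ y∈⁅b′⁆ = ⊥-elim (¬vb′ (proj₁ (∈Nbhd∩⁻ G B y∈Nv)))
      Nv≡b : Nbhd G v ∩ B ≡ ⁅ b ⁆
      Nv≡b = ⊆-antisym Nv⊆b (λ y∈⁅b⁆ → subst (_∈ Nbhd G v ∩ B) (sym (x∈⁅y⁆⇒x≡y b y∈⁅b⁆))
                                               (∈Nbhd∩⁺ G vb b∈B))

    v-adj-next-or-prev : ∀ {j₀} → c j₀ ∈ I → u ≡ ρ j₀ →
                         ¬ Adj G v (c (csuc j₀)) → ¬ Adj G v (c (cpred j₀)) → ⊥
    v-adj-next-or-prev {j₀} cj₀∈I refl ¬v-next ¬v-prev =
      cf u (c (csuc j₀)) (c (cpred j₀)) v u-next u-prev (proj₁ move) (next≢prev j₀)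
         (λ { refl → v∉B next∈B }) (λ { refl → v∉B prev∈B })
         (B-independent _ _ next∈B prev∈B) (¬v-next ∘ Adj-sym G) (¬v-prev ∘ Adj-sym G)
      where
      next∈B : c (csuc j₀) ∈ B
      next∈B = csuc-∈B cj₀∈I
      prev∈B : c (cpred j₀) ∈ B
      prev∈B = cpred-∈B cj₀∈I
      u-next : Adj G u (c (csuc j₀))
      u-next = ρ-adj cj₀∈I (c-csuc-adj j₀) next∈B
      u-prev : Adj G u (c (cpred j₀))
      u-prev = ρ-adj cj₀∈I (c-cpred-adj j₀) prev∈B

    move-dichotomy : (Nbhd G u ∩ B ≡ Nbhd G v ∩ B × Replica J′)
                   ⊎ (InN G 2 B u × InN G 1 B v × ¬ HasCycleIn G (J′ ∪ B))
    move-dichotomy with nonempty? (Nbhd G u ∩ B)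
    ... | no empty = inj₁ (Nu≡Nv , replica-after-move Nu≡Nv)
      where
      Nu≡Nv : Nbhd G u ∩ B ≡ Nbhd G v ∩ B
      Nu≡Nv = trans (Empty-unique empty)
                    (sym (Empty-unique (λ (y , y∈Nv) → empty (y , Nbhd-v∩B⊆Nbhd-u∩B y∈Nv))))
    ... | yes (y , y∈Nu) with ρ-cover u∈J (proj₂ (∈Nbhd∩⁻ G B y∈Nu)) (proj₁ (∈Nbhd∩⁻ G B y∈Nu))
    ...   | j₀ , cj₀∈I , u≡ρj₀ with Adj? G v (c (csuc j₀)) | Adj? G v (c (cpred j₀))
    ...     | yes v-next | yes v-prev = inj₁ (Nu≡Nv , replica-after-move Nu≡Nv)
      where
      Nu≡Nv : Nbhd G u ∩ B ≡ Nbhd G v ∩ B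
      Nu≡Nv = ⊆-antisym (subst (_⊆ Nbhd G v ∩ B) (sym (Nbhd-u∩B≡pair cj₀∈I u≡ρj₀))
                          (⁅x⁆∪⁅y⁆⊆Nbhd∩ G v-next v-prev (csuc-∈B cj₀∈I) (cpred-∈B cj₀∈I)))
                        Nbhd-v∩B⊆Nbhd-u∩B
    ...     | yes v-next | no ¬v-prev =
      inj₂ (resolving-move u≡ρj₀ (Nbhd-u∩B≡pair cj₀∈I u≡ρj₀) (next≢prev j₀) (csuc-∈B cj₀∈I)
                           v-next ¬v-prev)
    ...     | no ¬v-next | yes v-prev =
      inj₂ (resolving-move u≡ρj₀ (trans (Nbhd-u∩B≡pair cj₀∈I u≡ρj₀) (∪-comm _ _))
                           (next≢prev j₀ ∘ sym)
                           (cpred-∈B cj₀∈I) v-prev ¬v-next)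
    ...     | no ¬v-next | no ¬v-prev = ⊥-elim (v-adj-next-or-prev cj₀∈I u≡ρj₀ ¬v-next ¬v-prev)

  module Sequence {m : ℕ} {S : ℕ → Subset n} (ts : IsTSSeq G m S) (S₀≡I : S 0 ≡ I) where

    ResolvingMove : ℕ → Set
    ResolvingMove i = ∃[ u ] ∃[ v ] Move G (S i) (S (suc i)) u v × InN G 2 B u × InN G 1 B v

    PreservingMoveInto : ℕ → Set
    PreservingMoveInto i = ∀ i′ → i ≡ suc i′ → ∃[ u ] ∃[ v ] Move G (S i′) (S i) u v ×
                             (Nbhd G u ∩ B ≡ Nbhd G v ∩ B)

    Tracked : ℕ → Set
    Tracked i = Replica (S i) × PreservingMoveInto i

    ResolvedBefore : ℕ → Set
    ResolvedBefore i = ∃[ j ] j < i × ResolvingMove j × ¬ HasCycleIn G (S (suc j) ∪ B)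

    independent : ∀ {i} → i ≤ m → Independent G (S i)
    independent {i} = proj₁ ts i

    tracked-or-resolved : ∀ i → i ≤ m → Tracked i ⊎ ResolvedBefore i
    tracked-or-resolved zero    _   = inj₁ (subst Replica (sym S₀≡I) replica-I , λ _ ())
    tracked-or-resolved (suc i) i<m with tracked-or-resolved i (<⇒≤ i<m)
    ... | inj₂ (j , j<i , resolved) = inj₂ (j , m≤n⇒m≤1+n j<i , resolved)
    ... | inj₁ (R , _) with proj₂ ts i i<m
    ...   | u , v , move with ReplicaMove.move-dichotomy (independent (<⇒≤ i<m)) (independent i<m) R move
    ...     | inj₁ (Nu≡Nv , R′)       = inj₁ (R′ , λ { _ refl → u , v , move , Nu≡Nv })
    ...     | inj₂ (u∈N₂ , v∈N₁ , acyclic) =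
      inj₂ (i , ≤-refl , (u , v , move , u∈N₂ , v∈N₁) , acyclic)

    resolving⇔ : ContainsResolving G m S B ⇔ (∃[ i ] i < m × ResolvingMove i)
    resolving⇔ = mk⇔ to from
      where
      to : ContainsResolving G m S B → ∃[ i ] i < m × ResolvingMove i
      to (i , i≤m , acyclic) with tracked-or-resolved i i≤m
      ... | inj₁ (R , _) = ⊥-elim (acyclic (ReplicaProperties.replica-cycle (independent i≤m) R))
      ... | inj₂ (j , j<i , resolving , _) = j , <-≤-trans j<i i≤m , resolving
      from : ∃[ i ] i < m × ResolvingMove i → ContainsResolving G m S B
      from (i , i<m , u , v , move , u∈N₂ , v∈N₁) with tracked-or-resolved i (<⇒≤ i<m)
      ... | inj₂ (j , j<i , _ , acyclic) = suc j , ≤-trans j<i (<⇒≤ i<m) , acyclic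
      ... | inj₁ (R , _) with ReplicaMove.move-dichotomy (independent (<⇒≤ i<m)) (independent i<m) R move
      ...   | inj₁ (Nu≡Nv , _)
        with () ← trans (sym (proj₂ u∈N₂)) (trans (cong ∣_∣ Nu≡Nv) (proj₂ v∈N₁))
      ...   | inj₂ (_ , _ , acyclic) = suc i , i<m , acyclic

    unresolved⇒tracked : ∀ i → i ≤ m → ¬ ContainsResolving G i S B → Tracked i
    unresolved⇒tracked i i≤m unresolved with tracked-or-resolved i i≤m
    ... | inj₁ tracked = tracked
    ... | inj₂ (j , j<i , _ , acyclic) = ⊥-elim (unresolved (suc j , j<i , acyclic))

lemma22 : ∀ {n} (G : Graph n) → ClawFree G →
    (I : Subset n) → Independent G I →
    (k : ℕ) (c : Fin (3 + k) → Fin n) → IBadCycle G I k c →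
    (m : ℕ) (S : ℕ → Subset n) → IsTSSeq G m S → S 0 ≡ I →
    (ContainsResolving G m S (BPart G I c) ⇔
      (∃[ i ] i < m × ∃[ u ] ∃[ v ] Move G (S i) (S (suc i)) u v ×
        InN G 2 (BPart G I c) u × InN G 1 (BPart G I c) v))
    ×
    (∀ i → i ≤ m → ¬ ContainsResolving G i S (BPart G I c) →
      (∀ w → w ∈ S i → InN G 2 (BPart G I c) w ⊎ InN G 0 (BPart G I c) w)
      × (∀ i' → i ≡ suc i' → ∃[ u ] ∃[ v ] Move G (S i') (S i) u v ×
          (Nbhd G u ∩ BPart G I c ≡ Nbhd G v ∩ BPart G I c)))
lemma22 G cf I I-independent k c bad m S ts S₀≡I = resolving⇔ , unresolved
  where
  open BadCycle G cf I I-independent c bad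
  open Sequence ts S₀≡I
  unresolved : ∀ i → i ≤ m → ¬ ContainsResolving G i S B →
               (∀ w → w ∈ S i → InN G 2 B w ⊎ InN G 0 B w) × PreservingMoveInto i
  unresolved i i≤m ¬resolved with unresolved⇒tracked i i≤m ¬resolved
  ... | R , preserving = (λ _ → ReplicaProperties.replica-N₂⊎N₀ (independent i≤m) R) , preserving
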